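{- Let $r\geq 2$. Every $r$-uniform linear system $(P,\mathcal{L})$ with $\nu_2(P,\mathcal{L})=4$ and $\Delta(P,\mathcal{L})\geq 5$ satisfies $$\tau(P,\mathcal{L})\leq \frac{|P|+|\mathcal{L}|}{r+1}.$$
   Context: A linear system is a pair $(P,\mathcal{L})$ where $P$ is a finite set (points) and $\mathcal{L}$ is a family of subsets of $P$ (lines) such that $|l\cap l'|\leq 1$ for all distinct $l,l'\in\mathcal{L}$; it is $r$-uniform if every line has exactly $r$ points. The degree of a point is the number of lines containing it, and $\Delta(P,\mathcal{L})$ is the maximum degree. A transversal is a set $T\subseteq P$ meeting every line; $\tau(P,\mathcal{L})$ is the minimum size of a transversal. A 2-packing is a set $R\subseteq\mathcal{L}$ such that no three lines of $R$ have a common point; $\nu_2(P,\mathcal{L})$ is the maximum size of a 2-packing. -}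

module Defs where

open import Data.Nat using (ℕ; _≤_)
open import Data.Fin using (Fin)
open import Data.Fin.Subset using (Subset; _∈_; _∩_; ∣_∣; Nonempty)
open import Data.Vec using (tabulate; lookup)
open import Data.Product using (∃; _×_)
open import Relation.Binary.PropositionalEquality using (_≡_; _≢_)

LineFamily : ℕ → ℕ → Set
LineFamily n m = Fin m → Subset n

IsLinear : ∀ {n m} → LineFamily n m → Set
IsLinear {m = m} L = ∀ (i j : Fin m) → i ≢ j → ∣ L i ∩ L j ∣ ≤ 1

IsUniform : ∀ {n m} → ℕ → LineFamily n m → Set
IsUniform {m = m} r L = ∀ (i : Fin m) → ∣ L i ∣ ≡ r

linesThrough : ∀ {n m} → LineFamily n m → Fin n → Subset m
linesThrough L p = tabulate (λ i → lookup (L i) p)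

degree : ∀ {n m} → LineFamily n m → Fin n → ℕ
degree L p = ∣ linesThrough L p ∣

IsTransversal : ∀ {n m} → LineFamily n m → Subset n → Set
IsTransversal {m = m} L T = ∀ (i : Fin m) → Nonempty (T ∩ L i)

Is2Packing : ∀ {n m} → LineFamily n m → Subset m → Set
Is2Packing {n = n} L R = ∀ (p : Fin n) → ∣ R ∩ linesThrough L p ∣ ≤ 2

ν₂≡ : ∀ {n m} → LineFamily n m → ℕ → Set
ν₂≡ {m = m} L k = (∃ λ (R : Subset m) → Is2Packing L R × ∣ R ∣ ≡ k)
                × (∀ (R : Subset m) → Is2Packing L R → ∣ R ∣ ≤ k)

Δ≥ : ∀ {n m} → LineFamily n m → ℕ → Set
Δ≥ {n = n} L k = ∃ λ (p : Fin n) → k ≤ degree L p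

-- τ(L) ≤ (|P| + |L|)/(r+1) : some transversal T with |T|·(r+1) ≤ n + m

-- Fix a point p of degree at least 5. Any three distinct lines a, b, d missing p are concurrent:
-- otherwise discard the (at most three) lines through p that pass through a point where two of
-- a, b, d meet; two lines through p survive, and together with a, b, d they form a 2-packing of
-- size 5, contradicting ν₂ = 4. So either at most two lines miss p, or all of them pass through
-- one point q; in both cases p and two more points form a transversal. Three lines through p
-- cover 3r - 2 points and the lines through p number at least 5, whence 3(r + 1) ≤ |P| + |L|.

module Submission where

open import Defs
open import Data.Nat using (ℕ; suc; _≤_; _<_; _+_; _*_; z≤n; s≤s; s≤s⁻¹)
open import Data.Nat.Properties
  using (≤-refl; ≤-reflexive; ≤-trans; ≤-<-trans; <-irrefl; 1+n≰n; n≤1+n; m≤m+n;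
         +-mono-≤; +-monoˡ-≤; +-monoʳ-≤; +-assoc; +-comm; +-suc; +-identityʳ; *-suc; *-monoˡ-≤;
         module ≤-Reasoning)
open import Data.Fin using (Fin; _≟_)
open import Data.Fin.Properties using (any?)
open import Data.Fin.Subset
  using (Subset; inside; outside; _∈_; _∉_; _⊆_; _∩_; _∪_; _─_; _-_; ⁅_⁆; ⊥; ∣_∣; Nonempty; Empty)
open import Data.Fin.Subset.Properties
  using (_∈?_; ∉⊥; nonempty?; Empty-unique; ∣⊥∣≡0; ∣⁅x⁆∣≡1; ∣p∣≤n; ∣p∩q∣≤∣p∣; p⊆q⇒∣p∣≤∣q∣;
         ⊆-refl; ⊆-trans;
         x∈⁅x⁆; x∈⁅y⁆⇒x≡y; x∈p∩q⁺; x∈p∩q⁻; x∈p∪q⁺; x∈p∪q⁻; ∩-distribʳ-∪;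
         p─q⊆p; x∈p∧x≢y⇒x∈p-y; x∈p⇒∣p-x∣<∣p∣)
open import Data.List using (List; []; _∷_; length; map)
open import Data.Nat.ListAction using (sum)
open import Data.List.Membership.Propositional using () renaming (_∈_ to _∈ₗ_)
open import Data.List.Relation.Unary.Any using (here; there)
open import Data.List.Relation.Unary.All using (All; []; _∷_)
open import Data.List.Relation.Unary.AllPairs using ([]; _∷_)
open import Data.List.Relation.Unary.Unique.Propositional using (Unique)
open import Data.Vec using ([]; _∷_; here; there; lookup)
open import Data.Vec.Properties using (lookup∘tabulate; []=⇒lookup; lookup⇒[]=)
open import Data.Product using (∃; ∃₂; _×_; _,_)
open import Data.Sum as Sum using (_⊎_; inj₁; inj₂)
open import Data.Empty using (⊥-elim)
open import Relation.Nullary using (¬_; Dec; yes; no; ¬?; _×-dec_; contradiction)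
open import Relation.Binary.PropositionalEquality
  using (_≡_; _≢_; refl; sym; trans; cong; cong₂; subst; ≢-sym; module ≡-Reasoning)

private
  variable
    A B C : Set

indicator : Dec A → ℕ
indicator (yes _) = 1
indicator (no _)  = 0

indicator≤1 : (A? : Dec A) → indicator A? ≤ 1
indicator≤1 (yes _) = ≤-refl
indicator≤1 (no _)  = z≤n

-- The trailing + 0 in the next three statements is the shape of a sum over a three-element list.
at-most-two-of-three : (A? : Dec A) (B? : Dec B) (C? : Dec C) → ¬ (A × B × C) →
                       indicator A? + (indicator B? + (indicator C? + 0)) ≤ 2
at-most-two-of-three (yes a) (yes b) (yes c) ¬abc = contradiction (a , b , c) ¬abc
at-most-two-of-three (yes _) (yes _) (no _)  _    = ≤-refl
at-most-two-of-three (yes _) (no _)  C?      _    = s≤s (+-monoˡ-≤ 0 (indicator≤1 C?))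
at-most-two-of-three (no _)  B?      C?      _    =
  +-mono-≤ (indicator≤1 B?) (+-monoˡ-≤ 0 (indicator≤1 C?))

at-most-one-of-three : (A? : Dec A) (B? : Dec B) (C? : Dec C) →
                       ¬ (A × B) → ¬ (A × C) → ¬ (B × C) →
                       indicator A? + (indicator B? + (indicator C? + 0)) ≤ 1
at-most-one-of-three (yes a) (yes b) _       ¬ab _   _   = contradiction (a , b) ¬ab
at-most-one-of-three (yes a) (no _)  (yes c) _   ¬ac _   = contradiction (a , c) ¬ac
at-most-one-of-three (yes _) (no _)  (no _)  _   _   _   = ≤-refl
at-most-one-of-three (no _)  (yes b) (yes c) _   _   ¬bc = contradiction (b , c) ¬bc
at-most-one-of-three (no _)  (yes _) (no _)  _   _   _   = ≤-refl
at-most-one-of-three (no _)  (no _)  C?      _   _   _   = +-monoˡ-≤ 0 (indicator≤1 C?)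

none-of-three : (A? : Dec A) (B? : Dec B) (C? : Dec C) → ¬ A → ¬ B → ¬ C →
                indicator A? + (indicator B? + (indicator C? + 0)) ≡ 0
none-of-three (yes a) _       _       ¬a _  _  = contradiction a ¬a
none-of-three (no _)  (yes b) _       _  ¬b _  = contradiction b ¬b
none-of-three (no _)  (no _)  (yes c) _  _  ¬c = contradiction c ¬c
none-of-three (no _)  (no _)  (no _)  _  _  _  = refl

Empty⇒∣p∣≡0 : ∀ {n} {p : Subset n} → Empty p → ∣ p ∣ ≡ 0
Empty⇒∣p∣≡0 {n = n} e = trans (cong ∣_∣ (Empty-unique e)) (∣⊥∣≡0 n)

x∈p⇒0<∣p∣ : ∀ {n} {x : Fin n} {p} → x ∈ p → 0 < ∣ p ∣
x∈p⇒0<∣p∣ x∈p = ≤-<-trans z≤n (x∈p⇒∣p-x∣<∣p∣ x∈p)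

0<∣p∣⇒Nonempty : ∀ {n} {p : Subset n} → 0 < ∣ p ∣ → Nonempty p
0<∣p∣⇒Nonempty {p = p} 0<∣p∣ with nonempty? p
... | yes ne = ne
... | no ¬ne = contradiction (Empty⇒∣p∣≡0 ¬ne) λ ∣p∣≡0 → <-irrefl (sym ∣p∣≡0) 0<∣p∣

x∈p─q⇒x∉q : ∀ {n} {x : Fin n} (p q : Subset n) → x ∈ p ─ q → x ∉ q
x∈p─q⇒x∉q (_ ∷ p) (_ ∷ q) (there x∈p─q) (there x∈q) = x∈p─q⇒x∉q p q x∈p─q x∈q
x∈p─q⇒x∉q (_ ∷ p) (inside ∷ q) () here

x∈p-y⇒x≢y : ∀ {n} {x y : Fin n} {p} → x ∈ p - y → x ≢ y
x∈p-y⇒x≢y {y = y} {p} x∈p-y refl = x∈p─q⇒x∉q p ⁅ y ⁆ x∈p-y (x∈⁅x⁆ y)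

∣p∣≤1⇒x≡y : ∀ {n} {x y : Fin n} {p} → ∣ p ∣ ≤ 1 → x ∈ p → y ∈ p → x ≡ y
∣p∣≤1⇒x≡y {x = x} {y = y} ∣p∣≤1 x∈p y∈p with y ≟ x
... | yes y≡x = sym y≡x
... | no y≢x  = contradiction 1≤0 λ ()
  where
  1≤0 : 1 ≤ 0
  1≤0 = ≤-trans (x∈p⇒0<∣p∣ (x∈p∧x≢y⇒x∈p-y y∈p y≢x))
                (s≤s⁻¹ (≤-trans (x∈p⇒∣p-x∣<∣p∣ x∈p) ∣p∣≤1))

∣p∪q∣+∣p∩q∣≡∣p∣+∣q∣ : ∀ {n} (p q : Subset n) → ∣ p ∪ q ∣ + ∣ p ∩ q ∣ ≡ ∣ p ∣ + ∣ q ∣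
∣p∪q∣+∣p∩q∣≡∣p∣+∣q∣ []            []            = refl
∣p∪q∣+∣p∩q∣≡∣p∣+∣q∣ (inside ∷ p)  (inside ∷ q)  =
  cong suc (trans (+-suc _ _) (trans (cong suc (∣p∪q∣+∣p∩q∣≡∣p∣+∣q∣ p q)) (sym (+-suc _ _))))
∣p∪q∣+∣p∩q∣≡∣p∣+∣q∣ (inside ∷ p)  (outside ∷ q) = cong suc (∣p∪q∣+∣p∩q∣≡∣p∣+∣q∣ p q)
∣p∪q∣+∣p∩q∣≡∣p∣+∣q∣ (outside ∷ p) (inside ∷ q)  =
  trans (cong suc (∣p∪q∣+∣p∩q∣≡∣p∣+∣q∣ p q)) (sym (+-suc _ _))
∣p∪q∣+∣p∩q∣≡∣p∣+∣q∣ (outside ∷ p) (outside ∷ q) = ∣p∪q∣+∣p∩q∣≡∣p∣+∣q∣ p q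

∣p∪q∣≤∣p∣+∣q∣ : ∀ {n} (p q : Subset n) → ∣ p ∪ q ∣ ≤ ∣ p ∣ + ∣ q ∣
∣p∪q∣≤∣p∣+∣q∣ p q = ≤-trans (m≤m+n _ _) (≤-reflexive (∣p∪q∣+∣p∩q∣≡∣p∣+∣q∣ p q))

∣p∩q∣≤1⇒∣p∣+∣q∣≤∣p∪q∣+1 : ∀ {n} (p q : Subset n) → ∣ p ∩ q ∣ ≤ 1 → ∣ p ∣ + ∣ q ∣ ≤ ∣ p ∪ q ∣ + 1
∣p∩q∣≤1⇒∣p∣+∣q∣≤∣p∪q∣+1 p q ∣p∩q∣≤1 =
  ≤-trans (≤-reflexive (sym (∣p∪q∣+∣p∩q∣≡∣p∣+∣q∣ p q))) (+-monoʳ-≤ ∣ p ∪ q ∣ ∣p∩q∣≤1)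

Empty[p∩q]⇒∣p∪q∣≡∣p∣+∣q∣ : ∀ {n} (p q : Subset n) → Empty (p ∩ q) → ∣ p ∪ q ∣ ≡ ∣ p ∣ + ∣ q ∣
Empty[p∩q]⇒∣p∪q∣≡∣p∣+∣q∣ p q e = begin
  ∣ p ∪ q ∣                 ≡⟨ sym (+-identityʳ _) ⟩
  ∣ p ∪ q ∣ + 0             ≡⟨ cong (∣ p ∪ q ∣ +_) (sym (Empty⇒∣p∣≡0 e)) ⟩
  ∣ p ∪ q ∣ + ∣ p ∩ q ∣     ≡⟨ ∣p∪q∣+∣p∩q∣≡∣p∣+∣q∣ p q ⟩
  ∣ p ∣ + ∣ q ∣             ∎
  where open ≡-Reasoning

x∉p⇒Empty[⁅x⁆∩p] : ∀ {n} {x : Fin n} {p} → x ∉ p → Empty (⁅ x ⁆ ∩ p)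
x∉p⇒Empty[⁅x⁆∩p] {x = x} {p} x∉p (y , y∈⁅x⁆∩p) with x∈p∩q⁻ ⁅ x ⁆ p y∈⁅x⁆∩p
... | y∈⁅x⁆ , y∈p = x∉p (subst (_∈ p) (x∈⁅y⁆⇒x≡y x y∈⁅x⁆) y∈p)

∣⁅x⁆∩p∣≤indicator : ∀ {n} (x : Fin n) p → ∣ ⁅ x ⁆ ∩ p ∣ ≤ indicator (x ∈? p)
∣⁅x⁆∩p∣≤indicator x p with x ∈? p
... | yes _   = ≤-trans (∣p∩q∣≤∣p∣ ⁅ x ⁆ p) (≤-reflexive (∣⁅x⁆∣≡1 x))
... | no x∉p  = ≤-reflexive (Empty⇒∣p∣≡0 (x∉p⇒Empty[⁅x⁆∩p] x∉p))

∣p∣≤1+∣p-x∣ : ∀ {n} (p : Subset n) x → ∣ p ∣ ≤ suc ∣ p - x ∣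
∣p∣≤1+∣p-x∣ p x = begin
  ∣ p ∣                  ≤⟨ p⊆q⇒∣p∣≤∣q∣ p⊆⁅x⁆∪p-x ⟩
  ∣ ⁅ x ⁆ ∪ (p - x) ∣    ≤⟨ ∣p∪q∣≤∣p∣+∣q∣ ⁅ x ⁆ (p - x) ⟩
  ∣ ⁅ x ⁆ ∣ + ∣ p - x ∣  ≡⟨ cong (_+ ∣ p - x ∣) (∣⁅x⁆∣≡1 x) ⟩
  suc ∣ p - x ∣          ∎
  where
  open ≤-Reasoning
  p⊆⁅x⁆∪p-x : p ⊆ ⁅ x ⁆ ∪ (p - x)
  p⊆⁅x⁆∪p-x {y} y∈p with y ≟ x
  ... | yes refl = x∈p∪q⁺ (inj₁ (x∈⁅x⁆ x))
  ... | no y≢x   = x∈p∪q⁺ (inj₂ (x∈p∧x≢y⇒x∈p-y y∈p y≢x))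

two-distinct-members : ∀ {n} {p : Subset n} → 2 ≤ ∣ p ∣ → ∃₂ λ x y → x ∈ p × y ∈ p × x ≢ y
two-distinct-members {p = p} 2≤∣p∣ with 0<∣p∣⇒Nonempty (≤-trans (s≤s z≤n) 2≤∣p∣)
... | x , x∈p with 0<∣p∣⇒Nonempty (s≤s⁻¹ (≤-trans 2≤∣p∣ (∣p∣≤1+∣p-x∣ p x)))
...   | y , y∈p-x = x , y , x∈p , p─q⊆p p ⁅ x ⁆ y∈p-x , λ x≡y → x∈p-y⇒x≢y y∈p-x (sym x≡y)

three-distinct-members : ∀ {n} {p : Subset n} → 3 ≤ ∣ p ∣ →
  ∃₂ λ x y → ∃ λ z → x ∈ p × y ∈ p × z ∈ p × x ≢ y × x ≢ z × y ≢ z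
three-distinct-members {p = p} 3≤∣p∣ with 0<∣p∣⇒Nonempty (≤-trans (s≤s z≤n) 3≤∣p∣)
... | x , x∈p with two-distinct-members (s≤s⁻¹ (≤-trans 3≤∣p∣ (∣p∣≤1+∣p-x∣ p x)))
...   | y , z , y∈p-x , z∈p-x , y≢z =
  x , y , z , x∈p , p─q⊆p p ⁅ x ⁆ y∈p-x , p─q⊆p p ⁅ x ⁆ z∈p-x ,
  (λ x≡y → x∈p-y⇒x≢y y∈p-x (sym x≡y)) , (λ x≡z → x∈p-y⇒x≢y z∈p-x (sym x≡z)) , y≢z

fromList : ∀ {n} → List (Fin n) → Subset n
fromList []       = ⊥
fromList (x ∷ xs) = ⁅ x ⁆ ∪ fromList xs

countIn : ∀ {n} → Subset n → List (Fin n) → ℕ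
countIn p xs = sum (map (λ x → indicator (x ∈? p)) xs)

∈-fromList : ∀ {n} {x : Fin n} {xs} → x ∈ₗ xs → x ∈ fromList xs
∈-fromList {x = x} (here refl) = x∈p∪q⁺ (inj₁ (x∈⁅x⁆ x))
∈-fromList (there x∈xs)        = x∈p∪q⁺ (inj₂ (∈-fromList x∈xs))

∉-fromList : ∀ {n} {x : Fin n} {xs} → All (x ≢_) xs → x ∉ fromList xs
∉-fromList []                = ∉⊥
∉-fromList {xs = y ∷ xs} (x≢y ∷ x∉xs) x∈ with x∈p∪q⁻ ⁅ y ⁆ (fromList xs) x∈
... | inj₁ x∈⁅y⁆ = x≢y (x∈⁅y⁆⇒x≡y y x∈⁅y⁆)
... | inj₂ x∈xs  = ∉-fromList x∉xs x∈xs

∣fromList∣≤length : ∀ {n} (xs : List (Fin n)) → ∣ fromList xs ∣ ≤ length xs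
∣fromList∣≤length {n} []       = ≤-reflexive (∣⊥∣≡0 n)
∣fromList∣≤length      (x ∷ xs) = ≤-trans (∣p∪q∣≤∣p∣+∣q∣ ⁅ x ⁆ (fromList xs))
  (+-mono-≤ (≤-reflexive (∣⁅x⁆∣≡1 x)) (∣fromList∣≤length xs))

Unique⇒∣fromList∣≡length : ∀ {n} {xs : List (Fin n)} → Unique xs → ∣ fromList xs ∣ ≡ length xs
Unique⇒∣fromList∣≡length {n} {xs = []}     []               = ∣⊥∣≡0 n
Unique⇒∣fromList∣≡length     {xs = x ∷ xs} (x∉xs ∷ unique) = begin
  ∣ ⁅ x ⁆ ∪ fromList xs ∣        ≡⟨ Empty[p∩q]⇒∣p∪q∣≡∣p∣+∣q∣ ⁅ x ⁆ (fromList xs)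
                                      (x∉p⇒Empty[⁅x⁆∩p] (∉-fromList x∉xs)) ⟩
  ∣ ⁅ x ⁆ ∣ + ∣ fromList xs ∣    ≡⟨ cong₂ _+_ (∣⁅x⁆∣≡1 x) (Unique⇒∣fromList∣≡length unique) ⟩
  suc (length xs)                ∎
  where open ≡-Reasoning

∣fromList∩p∣≤countIn : ∀ {n} (xs : List (Fin n)) p → ∣ fromList xs ∩ p ∣ ≤ countIn p xs
∣fromList∩p∣≤countIn {n} []      p = ≤-trans (∣p∩q∣≤∣p∣ ⊥ p) (≤-reflexive (∣⊥∣≡0 n))
∣fromList∩p∣≤countIn     (x ∷ xs) p = begin
  ∣ (⁅ x ⁆ ∪ fromList xs) ∩ p ∣          ≡⟨ cong ∣_∣ (∩-distribʳ-∪ p ⁅ x ⁆ (fromList xs)) ⟩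
  ∣ (⁅ x ⁆ ∩ p) ∪ (fromList xs ∩ p) ∣    ≤⟨ ∣p∪q∣≤∣p∣+∣q∣ (⁅ x ⁆ ∩ p) (fromList xs ∩ p) ⟩
  ∣ ⁅ x ⁆ ∩ p ∣ + ∣ fromList xs ∩ p ∣    ≤⟨ +-mono-≤ (∣⁅x⁆∩p∣≤indicator x p)
                                                   (∣fromList∩p∣≤countIn xs p) ⟩
  indicator (x ∈? p) + countIn p xs      ∎
  where open ≤-Reasoning

module _ {n m} (L : LineFamily n m) where

  ∈-linesThrough⁻ : ∀ {i x} → i ∈ linesThrough L x → x ∈ L i
  ∈-linesThrough⁻ {i} {x} i∈Lx =
    lookup⇒[]= x (L i) (trans (sym (lookup∘tabulate (λ j → lookup (L j) x) i)) ([]=⇒lookup i∈Lx))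

  Concurrent : Fin m → Fin m → Fin m → Set
  Concurrent i j k = ∃ λ x → x ∈ L i × x ∈ L j × x ∈ L k

  concurrent? : ∀ i j k → Dec (Concurrent i j k)
  concurrent? i j k = any? λ x → x ∈? L i ×-dec x ∈? L j ×-dec x ∈? L k

  MissesMeetingPoints : Fin m → Fin m → Fin m → Fin m → Set
  MissesMeetingPoints a b d l = ¬ Concurrent l a b × ¬ Concurrent l a d × ¬ Concurrent l b d

  five-lines-distinct : ∀ {p l₁ l₂ a b d} → l₁ ≢ l₂ → p ∈ L l₁ → p ∈ L l₂ →
    a ≢ b → a ≢ d → b ≢ d → p ∉ L a → p ∉ L b → p ∉ L d → Unique (l₁ ∷ l₂ ∷ a ∷ b ∷ d ∷ [])
  five-lines-distinct {p} l₁≢l₂ p∈l₁ p∈l₂ a≢b a≢d b≢d p∉a p∉b p∉d =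
      (l₁≢l₂ ∷ apart p∈l₁ p∉a ∷ apart p∈l₁ p∉b ∷ apart p∈l₁ p∉d ∷ [])
    ∷ (apart p∈l₂ p∉a ∷ apart p∈l₂ p∉b ∷ apart p∈l₂ p∉d ∷ [])
    ∷ (a≢b ∷ a≢d ∷ []) ∷ (b≢d ∷ []) ∷ [] ∷ []
    where
    apart : ∀ {l k} → p ∈ L l → p ∉ L k → l ≢ k
    apart p∈l p∉k l≡k = p∉k (subst (λ l → p ∈ L l) l≡k p∈l)

  transversal-through-point : ∀ {p u v} → (∀ i → p ∉ L i → u ∈ L i ⊎ v ∈ L i) →
    IsTransversal L (fromList (p ∷ u ∷ v ∷ []))
  transversal-through-point {p} {u} {v} cover i with p ∈? L i
  ... | yes p∈i = p , x∈p∩q⁺ (∈-fromList {xs = p ∷ u ∷ v ∷ []} (here refl) , p∈i)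
  ... | no p∉i with cover i p∉i
  ...   | inj₁ u∈i = u , x∈p∩q⁺ (∈-fromList {xs = p ∷ u ∷ v ∷ []} (there (here refl)) , u∈i)
  ...   | inj₂ v∈i = v , x∈p∩q⁺ (∈-fromList {xs = p ∷ u ∷ v ∷ []} (there (there (here refl))) , v∈i)

module _ {n m} (L : LineFamily n m) (linear : IsLinear L) where

  meet-unique : ∀ {i j x y} → i ≢ j → x ∈ L i → x ∈ L j → y ∈ L i → y ∈ L j → x ≡ y
  meet-unique {i} {j} i≢j x∈i x∈j y∈i y∈j =
    ∣p∣≤1⇒x≡y (linear i j i≢j) (x∈p∩q⁺ (x∈i , x∈j)) (x∈p∩q⁺ (y∈i , y∈j))

  three-lines-through-a-point : ∀ {i j k p} → i ≢ j → i ≢ k → j ≢ k → p ∈ L i → p ∈ L j → p ∈ L k →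
    ∣ L i ∣ + (∣ L j ∣ + ∣ L k ∣) ≤ ∣ L i ∪ L j ∪ L k ∣ + 2
  three-lines-through-a-point {i} {j} {k} {p} i≢j i≢k j≢k p∈i p∈j p∈k = begin
    ∣ L i ∣ + (∣ L j ∣ + ∣ L k ∣)  ≤⟨ +-monoʳ-≤ ∣ L i ∣
                                      (∣p∩q∣≤1⇒∣p∣+∣q∣≤∣p∪q∣+1 (L j) (L k) (linear j k j≢k)) ⟩
    ∣ L i ∣ + (∣ L j ∪ L k ∣ + 1)  ≡⟨ sym (+-assoc ∣ L i ∣ _ 1) ⟩
    ∣ L i ∣ + ∣ L j ∪ L k ∣ + 1    ≤⟨ +-monoˡ-≤ 1
                                      (∣p∩q∣≤1⇒∣p∣+∣q∣≤∣p∪q∣+1 (L i) (L j ∪ L k) i∩[j∪k]≤1) ⟩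
    ∣ L i ∪ L j ∪ L k ∣ + 1 + 1    ≡⟨ +-assoc ∣ L i ∪ L j ∪ L k ∣ 1 1 ⟩
    ∣ L i ∪ L j ∪ L k ∣ + 2        ∎
    where
    open ≤-Reasoning
    i∩[j∪k]⊆⁅p⁆ : L i ∩ (L j ∪ L k) ⊆ ⁅ p ⁆
    i∩[j∪k]⊆⁅p⁆ {z} z∈ with x∈p∩q⁻ (L i) (L j ∪ L k) z∈
    ... | z∈i , z∈j∪k with x∈p∪q⁻ (L j) (L k) z∈j∪k
    ...   | inj₁ z∈j = subst (_∈ ⁅ p ⁆) (meet-unique i≢j p∈i p∈j z∈i z∈j) (x∈⁅x⁆ p)
    ...   | inj₂ z∈k = subst (_∈ ⁅ p ⁆) (meet-unique i≢k p∈i p∈k z∈i z∈k) (x∈⁅x⁆ p)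
    i∩[j∪k]≤1 : ∣ L i ∩ (L j ∪ L k) ∣ ≤ 1
    i∩[j∪k]≤1 = ≤-trans (p⊆q⇒∣p∣≤∣q∣ i∩[j∪k]⊆⁅p⁆) (≤-reflexive (∣⁅x⁆∣≡1 p))

  -- Two lines through p meet only at p ∉ L i, so at most one line through p passes through the
  -- meeting point of i and j.
  prune-concurrent : ∀ {p i j} → i ≢ j → p ∉ L i → (G : Subset m) → G ⊆ linesThrough L p →
    ∃ λ G′ → G′ ⊆ G × ∣ G ∣ ≤ suc ∣ G′ ∣ × (∀ {l} → l ∈ G′ → ¬ Concurrent L l i j)
  prune-concurrent {p} {i} {j} i≢j p∉i G G⊆Lp with any? (λ l → l ∈? G ×-dec concurrent? L l i j)
  ... | no ∄ = G , ⊆-refl , n≤1+n _ , λ l∈G l∩i∩j → ∄ (_ , l∈G , l∩i∩j)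
  ... | yes (l₀ , l₀∈G , z₀ , z₀∈l₀ , z₀∈i , z₀∈j) =
    G - l₀ , p─q⊆p G ⁅ l₀ ⁆ , ∣p∣≤1+∣p-x∣ G l₀ , excluded
    where
    excluded : ∀ {l} → l ∈ G - l₀ → ¬ Concurrent L l i j
    excluded {l} l∈G-l₀ (z , z∈l , z∈i , z∈j) = p∉i (subst (_∈ L i) (sym p≡z) z∈i)
      where
      p∈ : ∀ {l} → l ∈ G → p ∈ L l
      p∈ l∈G = ∈-linesThrough⁻ L (G⊆Lp l∈G)
      z₀≡z : z₀ ≡ z
      z₀≡z = meet-unique i≢j z₀∈i z₀∈j z∈i z∈j
      p≡z : p ≡ z
      p≡z = meet-unique (x∈p-y⇒x≢y l∈G-l₀) (p∈ (p─q⊆p G ⁅ l₀ ⁆ l∈G-l₀)) (p∈ l₀∈G)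
                        z∈l (subst (_∈ L l₀) z₀≡z z₀∈l₀)

  two-lines-missing-meeting-points : ∀ {p a b d} → 5 ≤ degree L p →
    a ≢ b → a ≢ d → b ≢ d → p ∉ L a → p ∉ L b →
    ∃₂ λ l₁ l₂ → l₁ ≢ l₂ × p ∈ L l₁ × p ∈ L l₂ ×
                 MissesMeetingPoints L a b d l₁ × MissesMeetingPoints L a b d l₂
  two-lines-missing-meeting-points {p} {a} {b} {d} 5≤deg a≢b a≢d b≢d p∉a p∉b
    with prune-concurrent a≢b p∉a (linesThrough L p) ⊆-refl
  ... | G₁ , G₁⊆Lp , ∣Lp∣≤ , miss-ab with prune-concurrent a≢d p∉a G₁ G₁⊆Lp
  ... | G₂ , G₂⊆G₁ , ∣G₁∣≤ , miss-ad with prune-concurrent b≢d p∉b G₂ (⊆-trans G₂⊆G₁ G₁⊆Lp)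
  ... | G₃ , G₃⊆G₂ , ∣G₂∣≤ , miss-bd
    with two-distinct-members {p = G₃}
           (s≤s⁻¹ (s≤s⁻¹ (s≤s⁻¹ (≤-trans 5≤deg (≤-trans ∣Lp∣≤ (s≤s (≤-trans ∣G₁∣≤ (s≤s ∣G₂∣≤))))))))
  ... | l₁ , l₂ , l₁∈G₃ , l₂∈G₃ , l₁≢l₂ =
    l₁ , l₂ , l₁≢l₂ , through l₁∈G₃ , through l₂∈G₃ , misses l₁∈G₃ , misses l₂∈G₃
    where
    through : ∀ {l} → l ∈ G₃ → p ∈ L l
    through l∈G₃ = ∈-linesThrough⁻ L (G₁⊆Lp (G₂⊆G₁ (G₃⊆G₂ l∈G₃)))
    misses : ∀ {l} → l ∈ G₃ → MissesMeetingPoints L a b d l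
    misses l∈G₃ = miss-ab (G₂⊆G₁ (G₃⊆G₂ l∈G₃)) , miss-ad (G₃⊆G₂ l∈G₃) , miss-bd l∈G₃

  five-lines-2-packing : ∀ {p l₁ l₂ a b d} → l₁ ≢ l₂ → p ∈ L l₁ → p ∈ L l₂ →
    p ∉ L a → p ∉ L b → p ∉ L d → ¬ Concurrent L a b d →
    MissesMeetingPoints L a b d l₁ → MissesMeetingPoints L a b d l₂ →
    Is2Packing L (fromList (l₁ ∷ l₂ ∷ a ∷ b ∷ d ∷ []))
  five-lines-2-packing {p} {l₁} {l₂} {a} {b} {d} l₁≢l₂ p∈l₁ p∈l₂ p∉a p∉b p∉d ¬abd miss₁ miss₂ x =
    ≤-trans (∣fromList∩p∣≤countIn (l₁ ∷ l₂ ∷ a ∷ b ∷ d ∷ []) T) (count≤2 (l₁ ∈? T) (l₂ ∈? T))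
    where
    T = linesThrough L x
    on : ∀ {l} → l ∈ T → x ∈ L l
    on = ∈-linesThrough⁻ L
    others : ℕ
    others = countIn T (a ∷ b ∷ d ∷ [])
    at-most-one-other : ∀ {l} → MissesMeetingPoints L a b d l → l ∈ T → others ≤ 1
    at-most-one-other (¬lab , ¬lad , ¬lbd) x∈l = at-most-one-of-three (a ∈? T) (b ∈? T) (d ∈? T)
      (λ (x∈a , x∈b) → ¬lab (x , on x∈l , on x∈a , on x∈b))
      (λ (x∈a , x∈d) → ¬lad (x , on x∈l , on x∈a , on x∈d))
      (λ (x∈b , x∈d) → ¬lbd (x , on x∈l , on x∈b , on x∈d))
    count≤2 : (x∈l₁? : Dec (l₁ ∈ T)) (x∈l₂? : Dec (l₂ ∈ T)) →
              indicator x∈l₁? + (indicator x∈l₂? + others) ≤ 2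
    count≤2 (yes x∈l₁) (yes x∈l₂) = ≤-reflexive (cong (2 +_) (none-of-three (a ∈? T) (b ∈? T) (d ∈? T)
      (missing p∉a) (missing p∉b) (missing p∉d)))
      where
      missing : ∀ {l} → p ∉ L l → l ∉ T
      missing p∉l x∈l = p∉l (subst (_∈ L _) (meet-unique l₁≢l₂ (on x∈l₁) (on x∈l₂) p∈l₁ p∈l₂) (on x∈l))
    count≤2 (yes x∈l₁) (no _)     = s≤s (at-most-one-other miss₁ x∈l₁)
    count≤2 (no _)     (yes x∈l₂) = s≤s (at-most-one-other miss₂ x∈l₂)
    count≤2 (no _)     (no _)     = at-most-two-of-three (a ∈? T) (b ∈? T) (d ∈? T)
      (λ (x∈a , x∈b , x∈d) → ¬abd (x , on x∈a , on x∈b , on x∈d))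

  lines-missing-point-concurrent : ∀ {p} → (∀ R → Is2Packing L R → ∣ R ∣ ≤ 4) → 5 ≤ degree L p →
    ∀ {a b d} → a ≢ b → a ≢ d → b ≢ d → p ∉ L a → p ∉ L b → p ∉ L d → Concurrent L a b d
  lines-missing-point-concurrent {p} ν₂≤4 5≤deg {a} {b} {d} a≢b a≢d b≢d p∉a p∉b p∉d
    with concurrent? L a b d
  ... | yes abd = abd
  ... | no ¬abd =
    let (l₁ , l₂ , l₁≢l₂ , p∈l₁ , p∈l₂ , miss₁ , miss₂) =
          two-lines-missing-meeting-points 5≤deg a≢b a≢d b≢d p∉a p∉b
        R = fromList (l₁ ∷ l₂ ∷ a ∷ b ∷ d ∷ [])
        5≡∣R∣ = sym (Unique⇒∣fromList∣≡length
                      (five-lines-distinct L l₁≢l₂ p∈l₁ p∈l₂ a≢b a≢d b≢d p∉a p∉b p∉d))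
        R-packing = five-lines-2-packing l₁≢l₂ p∈l₁ p∈l₂ p∉a p∉b p∉d ¬abd miss₁ miss₂
    in ⊥-elim (1+n≰n (≤-trans (≤-reflexive 5≡∣R∣) (ν₂≤4 R R-packing)))

module _ {n m} (L : LineFamily n m) (linear : IsLinear L) {p : Fin n}
         (point-on : ∀ i → Nonempty (L i))
         (concurrent : ∀ {a b d} → a ≢ b → a ≢ d → b ≢ d → p ∉ L a → p ∉ L b → p ∉ L d →
                       Concurrent L a b d) where

  cover-by-points-on : ∀ {a b} → (∀ i → p ∉ L i → i ≡ a ⊎ i ≡ b) →
    ∃₂ λ u v → ∀ i → p ∉ L i → u ∈ L i ⊎ v ∈ L i
  cover-by-points-on {a} {b} only-a-b with point-on a | point-on b
  ... | u , u∈a | v , v∈b =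
    u , v , λ i p∉i → Sum.map (λ { refl → u∈a }) (λ { refl → v∈b }) (only-a-b i p∉i)

  two-points-cover-lines-missing-point : ∃₂ λ u v → ∀ i → p ∉ L i → u ∈ L i ⊎ v ∈ L i
  two-points-cover-lines-missing-point with any? (λ i → ¬? (p ∈? L i))
  ... | no ∄ = p , p , λ i p∉i → ⊥-elim (∄ (i , p∉i))
  ... | yes (a , p∉a) with any? (λ i → ¬? (p ∈? L i) ×-dec ¬? (i ≟ a))
  ...   | no ∄ = cover-by-points-on only-a
    where
    only-a : ∀ i → p ∉ L i → i ≡ a ⊎ i ≡ a
    only-a i p∉i with i ≟ a
    ... | yes i≡a = inj₁ i≡a
    ... | no i≢a  = ⊥-elim (∄ (i , p∉i , i≢a))
  ...   | yes (b , p∉b , b≢a) with any? (λ i → ¬? (p ∈? L i) ×-dec ¬? (i ≟ a) ×-dec ¬? (i ≟ b))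
  ...     | no ∄ = cover-by-points-on only-a-b
    where
    only-a-b : ∀ i → p ∉ L i → i ≡ a ⊎ i ≡ b
    only-a-b i p∉i with i ≟ a | i ≟ b
    ... | yes i≡a | _       = inj₁ i≡a
    ... | no _    | yes i≡b = inj₂ i≡b
    ... | no i≢a  | no i≢b  = ⊥-elim (∄ (i , p∉i , i≢a , i≢b))
  ...     | yes (c , p∉c , c≢a , c≢b) with concurrent (≢-sym b≢a) (≢-sym c≢a) (≢-sym c≢b) p∉a p∉b p∉c
  ...       | q , q∈a , q∈b , _ = q , q , λ i p∉i → inj₁ (q∈ i p∉i)
    where
    q∈ : ∀ i → p ∉ L i → q ∈ L i
    q∈ i p∉i with i ≟ a | i ≟ b
    ... | yes refl | _        = q∈a
    ... | no _     | yes refl = q∈b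
    ... | no i≢a   | no i≢b   with concurrent (≢-sym b≢a) (≢-sym i≢a) (≢-sym i≢b) p∉a p∉b p∉i
    ...   | q′ , q′∈a , q′∈b , q′∈i =
      subst (_∈ L i) (meet-unique L linear (≢-sym b≢a) q′∈a q′∈b q∈a q∈b) q′∈i

uniform-lines-nonempty : ∀ {r n m} (L : LineFamily n m) → 1 ≤ r → IsUniform r L → ∀ i → Nonempty (L i)
uniform-lines-nonempty L 1≤r uniform i = 0<∣p∣⇒Nonempty (≤-trans 1≤r (≤-reflexive (sym (uniform i))))

three-lines-cover-3r-2-points : ∀ {r n m} (L : LineFamily n m) {p} → IsUniform r L → IsLinear L →
  3 ≤ degree L p → 3 * r ≤ n + 2
three-lines-cover-3r-2-points {r} {n} L {p} uniform linear 3≤deg =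
  let (i , j , k , i∈Lp , j∈Lp , k∈Lp , i≢j , i≢k , j≢k) =
        three-distinct-members {p = linesThrough L p} 3≤deg
  in begin
    3 * r                           ≡⟨ cong (λ t → r + (r + t)) (+-identityʳ r) ⟩
    r + (r + r)                     ≡⟨ sym (cong₂ _+_ (uniform i) (cong₂ _+_ (uniform j) (uniform k))) ⟩
    ∣ L i ∣ + (∣ L j ∣ + ∣ L k ∣)    ≤⟨ three-lines-through-a-point L linear i≢j i≢k j≢k
                                          (on i∈Lp) (on j∈Lp) (on k∈Lp) ⟩
    ∣ L i ∪ L j ∪ L k ∣ + 2         ≤⟨ +-monoˡ-≤ 2 (∣p∣≤n (L i ∪ L j ∪ L k)) ⟩
    n + 2                           ∎
  where
  open ≤-Reasoning
  on : ∀ {i} → i ∈ linesThrough L p → p ∈ L i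
  on = ∈-linesThrough⁻ L

corollary2p15 : ∀ (r n m : ℕ) (L : LineFamily n m) →
    2 ≤ r → IsUniform r L → IsLinear L → ν₂≡ L 4 → Δ≥ L 5 →
    ∃ λ (T : Subset n) → IsTransversal L T × ∣ T ∣ * suc r ≤ n + m
corollary2p15 r n m L 2≤r uniform linear (_ , ν₂≤4) (p , 5≤deg)
  with two-points-cover-lines-missing-point L linear
         (uniform-lines-nonempty L (≤-trans (s≤s z≤n) 2≤r) uniform)
         (lines-missing-point-concurrent L linear ν₂≤4 5≤deg)
... | u , v , cover = fromList (p ∷ u ∷ v ∷ []) , transversal-through-point L cover ,
  ≤-trans (*-monoˡ-≤ (suc r) (∣fromList∣≤length (p ∷ u ∷ v ∷ []))) 3[1+r]≤n+m
  where
  open ≤-Reasoning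
  3[1+r]≤n+m : 3 * suc r ≤ n + m
  3[1+r]≤n+m = begin
    3 * suc r    ≡⟨ *-suc 3 r ⟩
    3 + 3 * r    ≤⟨ +-monoʳ-≤ 3 (three-lines-cover-3r-2-points L uniform linear
                                   (≤-trans (m≤m+n 3 2) 5≤deg)) ⟩
    3 + (n + 2)  ≡⟨ +-comm 3 (n + 2) ⟩
    n + 2 + 3    ≡⟨ +-assoc n 2 3 ⟩
    n + 5        ≤⟨ +-monoʳ-≤ n (≤-trans 5≤deg (∣p∣≤n (linesThrough L p))) ⟩
    n + m        ∎
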